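{- Let $T$ be a topological space and let $\Vdash$ be the settling forcing relation over $T$ (defined in the context). Then $\Vdash$ is sound for constructive logic: if a formula $\phi(x_1,\dots,x_n)$ of the language of set theory is provable in intuitionistic first-order predicate logic, then for every open $J\subseteq T$ and all terms $\sigma_1,\dots,\sigma_n$ we have $J\Vdash\phi(\sigma_1,\dots,\sigma_n)$; moreover the set of formulas forced by a given open set is closed under intuitionistic logical consequence.
   Context: Work in a classical ground model $V$ of set theory and let $T$ be a topological space. Terms are defined recursively: a term is a set of the form $\{\langle\sigma_i,J_i\rangle : i\in I\}\cup\{\langle\sigma_h,r_h\rangle : h\in H\}$, where each $\sigma_i,\sigma_h$ is a term, each $J_i$ is an open subset of $T$, each $r_h$ is a point of $T$, and $I,H$ are index sets. For a set $x$, $\hat{x}=\{\langle\hat{y},T\rangle : y\in x\}$ (a ground model term). For a term $\sigma$ and $r\in T$, define recursively $\sigma^r=\{\langle\sigma_i^r,T\rangle : \langle\sigma_i,J_i\rangle\in\sigma,\ J_i \text{ open},\ r\in J_i\}\cup\{\langle\sigma_h^r,T\rangle : \langle\sigma_h,r\rangle\in\sigma\}$. Formulas are first-order formulas in $\in,=,\wedge,\vee,\rightarrow,\exists,\forall$ with terms as parameters ($\neg\phi$ abbreviates $\phi\rightarrow\bot$, where $\bot$ is a formula forced only by $\emptyset$, e.g. $\hat 0\in\hat 0$); for a formula $\phi$ with parameters $\sigma_0,\dots,\sigma_k$, $\phi^r$ is the formula with each $\sigma_j$ replaced by $\sigma_j^r$. For $J$ open, $J\Vdash\phi$ is defined by recursion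 (for $=$ and $\in$ simultaneously by recursion on terms): $J\Vdash\sigma=\tau$ iff for all $\langle\sigma_i,J_i\rangle\in\sigma$ with $J_i$ open, $J\cap J_i\Vdash\sigma_i\in\tau$, and for all $\langle\tau_i,J_i\rangle\in\tau$ with $J_i$ open, $J\cap J_i\Vdash\tau_i\in\sigma$, and for all $r\in J$, $\sigma^r=\tau^r$ (as sets); $J\Vdash\sigma\in\tau$ iff for all $r\in J$ there are $\langle\tau_i,J_i\rangle\in\tau$ with $J_i$ open and an open $J_r\subseteq J_i$ containing $r$ with $J_r\Vdash\sigma=\tau_i$; $J\Vdash\phi\wedge\psi$ iff $J\Vdash\phi$ and $J\Vdash\psi$; $J\Vdash\phi\vee\psi$ iff for all $r\in J$ there is an open $J_r\subseteq J$ containing $r$ with $J_r\Vdash\phi$ or $J_r\Vdash\psi$; $J\Vdash\phi\rightarrow\psi$ iff for all open $J'\subseteq J$, $J'\Vdash\phi$ implies $J'\Vdash\psi$, and for all $r\in J$ there is an open $J_r\subseteq J$ containing $r$ such that for all open $K\subseteq J_r$, $K\Vdash\phi^r$ implies $K\Vdash\psi^r$; $J\Vdash\exists x\,\phi(x)$ iff for all $r\in J$ there are an open $J_r\subseteq J$ containing $r$ and a term $\sigma$ with $J_r\Vdash\phi(\sigma)$; $J\Vdash\forall x\,\phi(x)$ iff for all terms $\sigma$, $J\Vdash\phi(\sigma)$, and for all $r\in J$ there is an open $J_r\subseteq J$ containing $r$ such that for all terms $\sigma$, $J_r\Vdash\phi^r(\sigma)$ (here $\sigma$ itself is not replaced by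 $\sigma^r$). -}

module Defs where

open import Level using (0ℓ)
open import Data.Unit using (⊤)
open import Data.Empty using (⊥; ⊥-elim)
open import Data.Nat using (ℕ; zero; suc)
open import Data.Fin using (Fin; zero; suc)
open import Data.Product using (Σ; _×_; _,_)
open import Data.Sum using (_⊎_; inj₁; inj₂)
open import Data.List using (List; []; _∷_; map)
open import Data.List.Membership.Propositional using (_∈_)
open import Relation.Binary.PropositionalEquality using (_≡_)

record Space : Set₂ where
  field
    Point : Set
    Open  : (Point → Set) → Set
    open-full : Open (λ _ → ⊤)
    open-∩    : ∀ {U V : Point → Set} → Open U → Open V → Open (λ x → U x × V x)
    open-⋃    : ∀ {I : Set} (U : I → Point → Set) → (∀ i → Open (U i))
              → Open (λ x → Σ I (λ i → U i x))
    open-ext  : ∀ {U V : Point → Set} → (∀ x → U x → V x) → (∀ x → V x → U x)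
              → Open U → Open V

module _ (T : Space) where
  open Space T

  Subset : Set₁
  Subset = Point → Set

  _∩_ : Subset → Subset → Subset
  (U ∩ V) x = U x × V x

  _⊆_ : Subset → Subset → Set
  U ⊆ V = ∀ x → U x → V x

  _≗ˢ_ : Subset → Subset → Set
  U ≗ˢ V = (U ⊆ V) × (V ⊆ U)

  Full : Subset
  Full _ = ⊤

  -- Terms: { ⟨σ i , J i⟩ : i ∈ I } ∪ { ⟨τ h , p h⟩ : h ∈ H },
  -- with J i open subsets and p h points of T.

  data Term : Set₁ where
    tm : (I : Set) (σ : I → Term) (J : I → Subset) (oJ : ∀ i → Open (J i))
         (H : Set) (τ : H → Term) (p : H → Point) → Term

  emptyTerm : Term
  emptyTerm = tm ⊥ ⊥-elim ⊥-elim (λ ()) ⊥ ⊥-elim ⊥-elim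

  data Idx^ (I : Set) (J : I → Subset) (H : Set) (p : H → Point) (r : Point) : Set where
    inO : (i : I) → J i r → Idx^ I J H p r
    inP : (h : H) → p h ≡ r → Idx^ I J H p r

  _^_ : Term → Point → Term
  sub^ : ∀ {I J H p r} (σ : I → Term) (τ : H → Term) → Idx^ I J H p r → Term
  tm I σ J oJ H τ p ^ r =
    tm (Idx^ I J H p r) (sub^ σ τ) (λ _ → Full) (λ _ → open-full) ⊥ ⊥-elim ⊥-elim
  sub^ {r = r} σ τ (inO i _) = σ i ^ r
  sub^ {r = r} σ τ (inP h _) = τ h ^ r

  -- equality of terms as sets (extensionality, pairs compared componentwise;
  -- open sets compared as sets of points, points compared by identity)
  _≋_ : Term → Term → Set₁
  tm I σ J _ H τ p ≋ tm I' σ' J' _ H' τ' p' =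
    (∀ i → Σ I' λ i' → (σ i ≋ σ' i') × (J i ≗ˢ J' i')) ×
    (∀ i' → Σ I λ i → (σ i ≋ σ' i') × (J i ≗ˢ J' i')) ×
    (∀ h → Σ H' λ h' → (τ h ≋ τ' h') × (p h ≡ p' h')) ×
    (∀ h' → Σ H λ h → (τ h ≋ τ' h') × (p h ≡ p' h'))

  ForcesEq : Subset → Term → Term → Set₁
  ForcesMem : Subset → Term → Term → Set₁

  ForcesEq J σ@(tm I σs Js _ _ _ _) τ@(tm I' τs Js' _ _ _ _) =
    (∀ i → ForcesMem (J ∩ Js i) (σs i) τ) ×
    (∀ i' → ForcesMem (J ∩ Js' i') (τs i') σ) ×
    (∀ r → J r → (σ ^ r) ≋ (τ ^ r))

  ForcesMem J σ (tm I' τs Js' _ _ _ _) =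
    ∀ r → J r → Σ I' λ i → Σ Subset λ K →
      Open K × (K ⊆ Js' i) × K r × ForcesEq K σ (τs i)

data Formula (n : ℕ) : Set where
  _≐_ _∈̇_ : Fin n → Fin n → Formula n
  ⊥̇ : Formula n
  _∧̇_ _∨̇_ _⇒_ : Formula n → Formula n → Formula n
  ∃̇ ∀̇ : Formula (suc n) → Formula n

ext : ∀ {n m} → (Fin n → Fin m) → Fin (suc n) → Fin (suc m)
ext f zero = zero
ext f (suc i) = suc (f i)

rename : ∀ {n m} → (Fin n → Fin m) → Formula n → Formula m
rename f (x ≐ y) = f x ≐ f y
rename f (x ∈̇ y) = f x ∈̇ f y
rename f ⊥̇ = ⊥̇
rename f (φ ∧̇ ψ) = rename f φ ∧̇ rename f ψ
rename f (φ ∨̇ ψ) = rename f φ ∨̇ rename f ψ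
rename f (φ ⇒ ψ) = rename f φ ⇒ rename f ψ
rename f (∃̇ φ) = ∃̇ (rename (ext f) φ)
rename f (∀̇ φ) = ∀̇ (rename (ext f) φ)

_[_] : ∀ {n} → Formula (suc n) → Fin n → Formula n
φ [ t ] = rename (λ { zero → t ; (suc i) → i }) φ

wk : ∀ {n} → Formula n → Formula (suc n)
wk = rename suc

infix 3 _⊢_
data _⊢_ {n : ℕ} : List (Formula n) → Formula n → Set where
  hyp  : ∀ {Γ φ} → φ ∈ Γ → Γ ⊢ φ
  ∧I   : ∀ {Γ φ ψ} → Γ ⊢ φ → Γ ⊢ ψ → Γ ⊢ φ ∧̇ ψ
  ∧E₁  : ∀ {Γ φ ψ} → Γ ⊢ φ ∧̇ ψ → Γ ⊢ φ
  ∧E₂  : ∀ {Γ φ ψ} → Γ ⊢ φ ∧̇ ψ → Γ ⊢ ψ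
  ∨I₁  : ∀ {Γ φ ψ} → Γ ⊢ φ → Γ ⊢ φ ∨̇ ψ
  ∨I₂  : ∀ {Γ φ ψ} → Γ ⊢ ψ → Γ ⊢ φ ∨̇ ψ
  ∨E   : ∀ {Γ φ ψ χ} → Γ ⊢ φ ∨̇ ψ → (φ ∷ Γ) ⊢ χ → (ψ ∷ Γ) ⊢ χ → Γ ⊢ χ
  ⇒I   : ∀ {Γ φ ψ} → (φ ∷ Γ) ⊢ ψ → Γ ⊢ φ ⇒ ψ
  ⇒E   : ∀ {Γ φ ψ} → Γ ⊢ φ ⇒ ψ → Γ ⊢ φ → Γ ⊢ ψ
  ⊥E   : ∀ {Γ φ} → Γ ⊢ ⊥̇ → Γ ⊢ φ
  ∀I   : ∀ {Γ φ} → map wk Γ ⊢ φ → Γ ⊢ ∀̇ φ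
  ∀E   : ∀ {Γ φ} → Γ ⊢ ∀̇ φ → (t : Fin n) → Γ ⊢ φ [ t ]
  ∃I   : ∀ {Γ φ} (t : Fin n) → Γ ⊢ φ [ t ] → Γ ⊢ ∃̇ φ
  ∃E   : ∀ {Γ φ ψ} → Γ ⊢ ∃̇ φ → (φ ∷ map wk Γ) ⊢ wk ψ → Γ ⊢ ψ
  refl≐  : ∀ {Γ} (x : Fin n) → Γ ⊢ x ≐ x
  subst≐ : ∀ {Γ} (φ : Formula (suc n)) {x y : Fin n}
         → Γ ⊢ x ≐ y → Γ ⊢ φ [ x ] → Γ ⊢ φ [ y ]

-- The settling forcing relation  J ⊩ φ(ρ 0, …, ρ (n-1))
-- (parameters supplied by an environment ρ; φ^r corresponds to ρ ^ r)

_∷ᵉ_ : ∀ {A : Set₁} {n} → A → (Fin n → A) → Fin (suc n) → A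
(a ∷ᵉ ρ) zero = a
(a ∷ᵉ ρ) (suc i) = ρ i

module _ (T : Space) where
  open Space T

  env^ : ∀ {n} → (Fin n → Term T) → Point → Fin n → Term T
  env^ ρ r x = _^_ T (ρ x) r

  Forces : ∀ {n} → Subset T → (Fin n → Term T) → Formula n → Set₁
  Forces J ρ (x ≐ y) = ForcesEq T J (ρ x) (ρ y)
  Forces J ρ (x ∈̇ y) = ForcesMem T J (ρ x) (ρ y)
  Forces J ρ ⊥̇ = ForcesMem T J (emptyTerm T) (emptyTerm T)
  Forces J ρ (φ ∧̇ ψ) = Forces J ρ φ × Forces J ρ ψ
  Forces J ρ (φ ∨̇ ψ) =
    ∀ r → J r → Σ (Subset T) λ K → Open K × _⊆_ T K J × K r ×
      (Forces K ρ φ ⊎ Forces K ρ ψ)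
  Forces J ρ (φ ⇒ ψ) =
    (∀ K → Open K → _⊆_ T K J → Forces K ρ φ → Forces K ρ ψ) ×
    (∀ r → J r → Σ (Subset T) λ K → Open K × _⊆_ T K J × K r ×
      (∀ K' → Open K' → _⊆_ T K' K →
         Forces K' (env^ ρ r) φ → Forces K' (env^ ρ r) ψ))
  Forces J ρ (∃̇ φ) =
    ∀ r → J r → Σ (Subset T) λ K → Open K × _⊆_ T K J × K r ×
      Σ (Term T) λ σ → Forces K (σ ∷ᵉ ρ) φ
  Forces J ρ (∀̇ φ) =
    (∀ σ → Forces J (σ ∷ᵉ ρ) φ) ×
    (∀ r → J r → Σ (Subset T) λ K → Open K × _⊆_ T K J × K r ×
      (∀ σ → Forces K (σ ∷ᵉ env^ ρ r) φ))

-- Forcing is monotone (it passes to open subsets) and local (an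
-- open set forces φ as soon as the sets of an open cover of it do); locality gives
-- ∨E, ∃E and ⊥E, an open set forcing ⊥̇ being empty. Forcing also localises: from
-- J ⊩ φ(ρ) and r ∈ J one gets an open neighbourhood of r forcing φ(ρ ^ r), which
-- supplies the pointwise clauses of ⇒ and ∀ in ⇒I and ∀I. This rests on (σ ^ r) ^ s
-- and σ ^ r being equal as sets, so that for parameters of the form σ ^ r the
-- pointwise clauses follow from the global ones. Finally ⊩ _ ≐ _ is an equivalence
-- compatible with ∈̇, so forcing is invariant under replacing parameters by
-- forced-equal ones, which gives the equality rules.

module Submission where

open import Defs hiding (_⊆_; _∩_; _≗ˢ_; _^_; _≋_)
open import Data.Nat using (ℕ; suc)
open import Data.Fin using (Fin; zero; suc)
open import Data.Product using (_×_; Σ; _,_; proj₁; proj₂; swap; map₁)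
open import Data.Sum using (inj₁; inj₂; [_,_]′)
import Data.Sum as Sum
open import Data.List using (List; []; _∷_; map)
open import Data.List.Relation.Unary.All using (All; []; _∷_; lookup)
import Data.List.Relation.Unary.All as All
open import Data.List.Relation.Unary.All.Properties using (map⁺)
open import Data.Unit using (tt)
open import Data.Empty using (⊥-elim)
open import Function using (_∘_)
open import Relation.Binary.PropositionalEquality
  using (refl; sym; trans; cong; subst; subst₂; _≗_)
open import Relation.Nullary using (¬_)

module Soundness (T : Space) where
  open Space T

  infixr 7 _∩_
  infixl 30 _^_ _^ᵉ_
  infix 4 _⊆_ _≗ˢ_ _≋_ _⊩_≐_ _⊩_∈̇_ _⊩_≐ᵉ_ _⊩[_]_

  _⊆_ : Subset T → Subset T → Set
  _⊆_ = Defs._⊆_ T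

  _∩_ : Subset T → Subset T → Subset T
  _∩_ = Defs._∩_ T

  _≗ˢ_ : Subset T → Subset T → Set
  _≗ˢ_ = Defs._≗ˢ_ T

  _^_ : Term T → Point → Term T
  _^_ = Defs._^_ T

  _≋_ : Term T → Term T → Set₁
  _≋_ = Defs._≋_ T

  Env : ℕ → Set₁
  Env n = Fin n → Term T

  _^ᵉ_ : ∀ {n} → Env n → Point → Env n
  _^ᵉ_ = env^ T

  _⊩_≐_ : Subset T → Term T → Term T → Set₁
  _⊩_≐_ = ForcesEq T

  _⊩_∈̇_ : Subset T → Term T → Term T → Set₁
  _⊩_∈̇_ = ForcesMem T

  _⊩[_]_ : ∀ {n} → Subset T → Env n → Formula n → Set₁
  _⊩[_]_ = Forces T

  variable
    n : ℕ
    J K L : Subset T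
    r : Point
    ρ ρ' : Env n
    P Q : Subset T → Set₁

  ⊆-refl : K ⊆ K
  ⊆-refl _ k = k

  ⊆-trans : L ⊆ K → K ⊆ J → L ⊆ J
  ⊆-trans L⊆K K⊆J x = K⊆J x ∘ L⊆K x

  ∩-⊆ˡ : J ∩ K ⊆ J
  ∩-⊆ˡ _ = proj₁

  ∩-⊆ʳ : J ∩ K ⊆ K
  ∩-⊆ʳ _ = proj₂

  ≗ˢ-refl : K ≗ˢ K
  ≗ˢ-refl = ⊆-refl , ⊆-refl

  ≗ˢ-trans : J ≗ˢ K → K ≗ˢ L → J ≗ˢ L
  ≗ˢ-trans (J⊆K , K⊆J) (K⊆L , L⊆K) = ⊆-trans J⊆K K⊆L , ⊆-trans L⊆K K⊆J

  ≋-refl : ∀ a → a ≋ a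
  ≋-refl (tm _ σ _ _ _ τ _) =
    (λ i → i , ≋-refl (σ i) , ≗ˢ-refl) ,
    (λ i → i , ≋-refl (σ i) , ≗ˢ-refl) ,
    (λ h → h , ≋-refl (τ h) , refl) ,
    (λ h → h , ≋-refl (τ h) , refl)

  ≋-sym : ∀ a b → a ≋ b → b ≋ a
  ≋-sym (tm _ σ _ _ _ τ _) (tm _ σ' _ _ _ τ' _) (f , g , u , v) =
    (λ i' → let (i , e , J≗J') = g i' in i , ≋-sym (σ i) (σ' i') e , swap J≗J') ,
    (λ i → let (i' , e , J≗J') = f i in i' , ≋-sym (σ i) (σ' i') e , swap J≗J') ,
    (λ h' → let (h , e , p≡p') = v h' in h , ≋-sym (τ h) (τ' h') e , sym p≡p') ,
    (λ h → let (h' , e , p≡p') = u h in h' , ≋-sym (τ h) (τ' h') e , sym p≡p')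

  ≋-trans : ∀ a b c → a ≋ b → b ≋ c → a ≋ c
  ≋-trans (tm _ σ _ _ _ τ _) (tm _ σ' _ _ _ τ' _) (tm _ σ'' _ _ _ τ'' _)
          (f , g , u , v) (f' , g' , u' , v') =
    (λ i → let (j , e , J≗J') = f i ; (k , e' , J'≗J'') = f' j in
       k , ≋-trans (σ i) (σ' j) (σ'' k) e e' , ≗ˢ-trans J≗J' J'≗J'') ,
    (λ k → let (j , e' , J'≗J'') = g' k ; (i , e , J≗J') = g j in
       i , ≋-trans (σ i) (σ' j) (σ'' k) e e' , ≗ˢ-trans J≗J' J'≗J'') ,
    (λ h → let (j , e , p≡p') = u h ; (k , e' , p'≡p'') = u' j in
       k , ≋-trans (τ h) (τ' j) (τ'' k) e e' , trans p≡p' p'≡p'') ,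
    (λ k → let (j , e' , p'≡p'') = v' k ; (h , e , p≡p') = v j in
       h , ≋-trans (τ h) (τ' j) (τ'' k) e e' , trans p≡p' p'≡p'')

  ^-cong : ∀ a b r → a ≋ b → a ^ r ≋ b ^ r
  ^-cong (tm _ σ _ _ _ τ _) (tm _ σ' _ _ _ τ' _) r (f , g , u , v) =
    (λ { (inO i ri) → let (i' , e , J⊆J' , _) = f i in
           inO i' (J⊆J' r ri) , ^-cong (σ i) (σ' i') r e , ≗ˢ-refl
       ; (inP h ph≡r) → let (h' , e , p≡p') = u h in
           inP h' (trans (sym p≡p') ph≡r) , ^-cong (τ h) (τ' h') r e , ≗ˢ-refl }) ,
    (λ { (inO i' ri') → let (i , e , _ , J'⊆J) = g i' in
           inO i (J'⊆J r ri') , ^-cong (σ i) (σ' i') r e , ≗ˢ-refl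
       ; (inP h' p'h'≡r) → let (h , e , p≡p') = v h' in
           inP h (trans p≡p' p'h'≡r) , ^-cong (τ h) (τ' h') r e , ≗ˢ-refl }) ,
    (λ ()) , (λ ())

  ^-idem : ∀ a r s → a ^ r ^ s ≋ a ^ r
  ^-idem (tm _ σ _ _ _ τ _) r s =
    (λ { (inO (inO i ri) _) → inO i ri , ^-idem (σ i) r s , ≗ˢ-refl
       ; (inO (inP h ph≡r) _) → inP h ph≡r , ^-idem (τ h) r s , ≗ˢ-refl
       ; (inP () _) }) ,
    (λ { (inO i ri) → inO (inO i ri) tt , ^-idem (σ i) r s , ≗ˢ-refl
       ; (inP h ph≡r) → inO (inP h ph≡r) tt , ^-idem (τ h) r s , ≗ˢ-refl }) ,
    (λ ()) , (λ ())

  ⊩∈̇-mono : ∀ a b → K ⊆ J → J ⊩ a ∈̇ b → K ⊩ a ∈̇ b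
  ⊩∈̇-mono _ (tm _ _ _ _ _ _ _) K⊆J a∈b r Kr = a∈b r (K⊆J r Kr)

  ⊩≐-mono : ∀ a b → K ⊆ J → J ⊩ a ≐ b → K ⊩ a ≐ b
  ⊩≐-mono a@(tm _ σ _ _ _ _ _) b@(tm _ τ _ _ _ _ _) K⊆J (a⊆b , b⊆a , a≋b) =
    (λ i → ⊩∈̇-mono (σ i) b (λ x → map₁ (K⊆J x)) (a⊆b i)) ,
    (λ i → ⊩∈̇-mono (τ i) a (λ x → map₁ (K⊆J x)) (b⊆a i)) ,
    (λ r Kr → a≋b r (K⊆J r Kr))

  ⊩≐-sym : ∀ a b → J ⊩ a ≐ b → J ⊩ b ≐ a
  ⊩≐-sym a@(tm _ _ _ _ _ _ _) b@(tm _ _ _ _ _ _ _) (a⊆b , b⊆a , a≋b) =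
    b⊆a , a⊆b , λ r Jr → ≋-sym (a ^ r) (b ^ r) (a≋b r Jr)

  ≋⇒⊩≐ : ∀ J a b → a ≋ b → J ⊩ a ≐ b
  ≋⇒⊩≐ J a@(tm _ σ A oA _ _ _) b@(tm _ τ B oB _ _ _) a≋b@(f , g , _ , _) =
    (λ i r (_ , Ar) → let (i' , e , A⊆B , _) = f i in
       i' , B i' , oB i' , ⊆-refl , A⊆B r Ar , ≋⇒⊩≐ (B i') (σ i) (τ i') e) ,
    (λ i' r (_ , Br) → let (i , e , _ , B⊆A) = g i' in
       i , A i , oA i , ⊆-refl , B⊆A r Br , ⊩≐-sym (σ i) (τ i') (≋⇒⊩≐ (A i) (σ i) (τ i') e)) ,
    (λ r _ → ^-cong a b r a≋b)

  ⊩≐-refl : ∀ J a → J ⊩ a ≐ a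
  ⊩≐-refl J a = ≋⇒⊩≐ J a a (≋-refl a)

  ⊩≐⇒^≋ : ∀ a b → J ⊩ a ≐ b → J r → a ^ r ≋ b ^ r
  ⊩≐⇒^≋ (tm _ _ _ _ _ _ _) (tm _ _ _ _ _ _ _) (_ , _ , a≋b) Jr = a≋b _ Jr

  ⊩∈̇-respʳ : ∀ a b c → J ⊩ a ∈̇ b → J ⊩ b ≐ c → J ⊩ a ∈̇ c
  ⊩≐-trans : ∀ a b c → J ⊩ a ≐ b → J ⊩ b ≐ c → J ⊩ a ≐ c

  ⊩∈̇-respʳ a (tm _ σ _ _ _ _ _) c@(tm _ τ C _ _ _ _) a∈b (b⊆c , _) r Jr =
    let (j , K , oK , K⊆B , Kr , a≐σ) = a∈b r Jr
        (k , L , oL , L⊆C , Lr , σ≐τ) = b⊆c j r (Jr , K⊆B r Kr)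
    in k , K ∩ L , open-∩ oK oL , ⊆-trans ∩-⊆ʳ L⊆C , (Kr , Lr) ,
       ⊩≐-trans a (σ j) (τ k) (⊩≐-mono a (σ j) ∩-⊆ˡ a≐σ) (⊩≐-mono (σ j) (τ k) ∩-⊆ʳ σ≐τ)

  ⊩≐-trans a@(tm _ σ _ _ _ _ _) b@(tm _ _ _ _ _ _ _) c@(tm _ τ _ _ _ _ _)
           a≐b@(a⊆b , _ , a≋b) b≐c@(_ , c⊆b , b≋c) =
    (λ i → ⊩∈̇-respʳ (σ i) b c (a⊆b i) (⊩≐-mono b c ∩-⊆ˡ b≐c)) ,
    (λ k → ⊩∈̇-respʳ (τ k) b a (c⊆b k) (⊩≐-mono b a ∩-⊆ˡ (⊩≐-sym a b a≐b))) ,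
    (λ r Jr → ≋-trans (a ^ r) (b ^ r) (c ^ r) (a≋b r Jr) (b≋c r Jr))

  ⊩∈̇-respˡ : Open J → ∀ a a' b → J ⊩ a ≐ a' → J ⊩ a ∈̇ b → J ⊩ a' ∈̇ b
  ⊩∈̇-respˡ {J = J} oJ a a' (tm _ σ _ _ _ _ _) a≐a' a∈b r Jr =
    let (i , K , oK , K⊆B , Kr , a≐σ) = a∈b r Jr in
    i , K ∩ J , open-∩ oK oJ , ⊆-trans ∩-⊆ˡ K⊆B , (Kr , Jr) ,
    ⊩≐-trans a' a (σ i) (⊩≐-mono a' a ∩-⊆ʳ (⊩≐-sym a a' a≐a')) (⊩≐-mono a (σ i) ∩-⊆ˡ a≐σ)

  -- The members of b ^ r carry the full space as their open set, so the membership
  -- holds on every K.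
  ⊩∈̇-^ : ∀ a b → J ⊩ a ∈̇ b → J r → K ⊩ a ^ r ∈̇ b ^ r
  ⊩∈̇-^ {r = r} a (tm _ σ _ _ _ _ _) a∈b Jr _ _ =
    let (i , K , _ , K⊆B , Kr , a≐σ) = a∈b r Jr in
    inO i (K⊆B r Kr) , Full T , open-full , (λ _ _ → tt) , tt ,
    ≋⇒⊩≐ (Full T) (a ^ r) (σ i ^ r) (⊩≐⇒^≋ a (σ i) a≐σ Kr)

  ⊩≐-^ : ∀ a b → J ⊩ a ≐ b → J r → K ⊩ a ^ r ≐ b ^ r
  ⊩≐-^ {K = K} a b a≐b Jr = ≋⇒⊩≐ K _ _ (⊩≐⇒^≋ a b a≐b Jr)

  ⊩⊥̇⇒empty : J ⊩ emptyTerm T ∈̇ emptyTerm T → ¬ J r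
  ⊩⊥̇⇒empty ∅∈∅ Jr = proj₁ (∅∈∅ _ Jr)

  Nbhd : Subset T → Point → (Subset T → Set₁) → Set₁
  Nbhd J r P = Σ (Subset T) λ K → Open K × K ⊆ J × K r × P K

  -- The clauses of Forces for ∨̇ and ∃̇ are literally of the form Locally J P.
  Locally : Subset T → (Subset T → Set₁) → Set₁
  Locally J P = ∀ r → J r → Nbhd J r P

  Monotone : (Subset T → Set₁) → Set₁
  Monotone P = ∀ {K L} → Open L → L ⊆ K → P K → P L

  nbhd-refl : Open J → J r → P J → Nbhd J r P
  nbhd-refl oJ Jr p = _ , oJ , ⊆-refl , Jr , p

  nbhd-map : (∀ {K} → Open K → K ⊆ J → P K → Q K) → Nbhd J r P → Nbhd J r Q
  nbhd-map f (K , oK , K⊆J , Kr , p) = K , oK , K⊆J , Kr , f oK K⊆J p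

  nbhd-bind : Nbhd J r P → (∀ {K} → Open K → K r → P K → Nbhd K r Q) → Nbhd J r Q
  nbhd-bind (K , oK , K⊆J , Kr , p) k =
    let (L , oL , L⊆K , Lr , q) = k oK Kr p in L , oL , ⊆-trans L⊆K K⊆J , Lr , q

  nbhd-restrict : Monotone P → Open K → K r → Nbhd J r P → Nbhd K r P
  nbhd-restrict mono oK Kr (L , oL , _ , Lr , p) =
    L ∩ _ , open-∩ oL oK , ∩-⊆ʳ , (Lr , Kr) , mono (open-∩ oL oK) ∩-⊆ˡ p

  nbhd-× : Monotone P → Monotone Q → Nbhd J r P → Nbhd J r Q → Nbhd J r (λ K → P K × Q K)
  nbhd-× monoP monoQ (K , oK , K⊆J , Kr , p) (L , oL , _ , Lr , q) =
    K ∩ L , open-∩ oK oL , ⊆-trans ∩-⊆ˡ K⊆J , (Kr , Lr) ,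
    monoP (open-∩ oK oL) ∩-⊆ˡ p , monoQ (open-∩ oK oL) ∩-⊆ʳ q

  locally-refl : Open J → P J → Locally J P
  locally-refl oJ p r Jr = nbhd-refl oJ Jr p

  locally-map : (∀ {K} → Open K → K ⊆ J → P K → Q K) → Locally J P → Locally J Q
  locally-map f cover r Jr = nbhd-map f (cover r Jr)

  locally-restrict : Monotone P → Open K → K ⊆ J → Locally J P → Locally K P
  locally-restrict mono oK K⊆J cover r Kr = nbhd-restrict mono oK Kr (cover r (K⊆J r Kr))

  locally-join : Locally J (λ K → Locally K P) → Locally J P
  locally-join cover r Jr = nbhd-bind (cover r Jr) λ _ Kr cover' → cover' r Kr

  ⊩∈̇-glue : ∀ a b → Locally J (_⊩ a ∈̇ b) → J ⊩ a ∈̇ b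
  ⊩∈̇-glue _ (tm _ _ _ _ _ _ _) cover r Jr =
    let (_ , _ , _ , Kr , a∈b) = cover r Jr in a∈b r Kr

  ⊩≐-glue : ∀ a b → Locally J (_⊩ a ≐ b) → J ⊩ a ≐ b
  ⊩≐-glue (tm _ _ _ _ _ _ _) (tm _ _ _ _ _ _ _) cover =
    (λ i r (Jr , Ar) → let (_ , _ , _ , Kr , (a⊆b , _)) = cover r Jr in a⊆b i r (Kr , Ar)) ,
    (λ i r (Jr , Br) → let (_ , _ , _ , Kr , (_ , b⊆a , _)) = cover r Jr in b⊆a i r (Kr , Br)) ,
    (λ r Jr → let (_ , _ , _ , Kr , (_ , _ , a≋b)) = cover r Jr in a≋b r Kr)

  _⊩_≐ᵉ_ : Subset T → Env n → Env n → Set₁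
  J ⊩ ρ ≐ᵉ ρ' = ∀ x → J ⊩ ρ x ≐ ρ' x

  ≐ᵉ-refl : ∀ J (ρ : Env n) → J ⊩ ρ ≐ᵉ ρ
  ≐ᵉ-refl J ρ x = ⊩≐-refl J (ρ x)

  ≐ᵉ-reflexive : ρ ≗ ρ' → J ⊩ ρ ≐ᵉ ρ'
  ≐ᵉ-reflexive {ρ = ρ} {J = J} ρ≗ρ' x = subst (J ⊩ ρ x ≐_) (ρ≗ρ' x) (⊩≐-refl J (ρ x))

  ≐ᵉ-sym : J ⊩ ρ ≐ᵉ ρ' → J ⊩ ρ' ≐ᵉ ρ
  ≐ᵉ-sym {ρ = ρ} {ρ' = ρ'} ρ≐ρ' x = ⊩≐-sym (ρ x) (ρ' x) (ρ≐ρ' x)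

  ≐ᵉ-mono : K ⊆ J → J ⊩ ρ ≐ᵉ ρ' → K ⊩ ρ ≐ᵉ ρ'
  ≐ᵉ-mono {ρ = ρ} {ρ' = ρ'} K⊆J ρ≐ρ' x = ⊩≐-mono (ρ x) (ρ' x) K⊆J (ρ≐ρ' x)

  ≐ᵉ-∷ : ∀ {σ τ} → J ⊩ σ ≐ τ → J ⊩ ρ ≐ᵉ ρ' → J ⊩ σ ∷ᵉ ρ ≐ᵉ τ ∷ᵉ ρ'
  ≐ᵉ-∷ σ≐τ _ zero = σ≐τ
  ≐ᵉ-∷ _ ρ≐ρ' (suc x) = ρ≐ρ' x

  ≐ᵉ-^ : J ⊩ ρ ≐ᵉ ρ' → J r → K ⊩ ρ ^ᵉ r ≐ᵉ ρ' ^ᵉ r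
  ≐ᵉ-^ {ρ = ρ} {ρ' = ρ'} ρ≐ρ' Jr x = ⊩≐-^ (ρ x) (ρ' x) (ρ≐ρ' x) Jr

  ^ᵉ-∷ᵉ : ∀ σ (ρ : Env n) r → (σ ∷ᵉ ρ) ^ᵉ r ≗ σ ^ r ∷ᵉ ρ ^ᵉ r
  ^ᵉ-∷ᵉ _ _ _ zero = refl
  ^ᵉ-∷ᵉ _ _ _ (suc _) = refl

  ∷ᵉ-≗ : ∀ {m} {f : Fin m → Fin n} {ρ : Env n} {ρ' : Env m} {σ}
       → ρ' ≗ ρ ∘ f → σ ∷ᵉ ρ' ≗ (σ ∷ᵉ ρ) ∘ ext f
  ∷ᵉ-≗ _ zero = refl
  ∷ᵉ-≗ ρ'≗ρf (suc x) = ρ'≗ρf x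

  ^ᵉ-≗ : ∀ {m} (ρ : Env n) (f : Fin m → Fin n) {ρ' : Env m}
       → ρ' ≗ ρ ∘ f → ρ' ^ᵉ r ≗ (ρ ^ᵉ r) ∘ f
  ^ᵉ-≗ {r = r} _ _ ρ'≗ρf x = cong (_^ r) (ρ'≗ρf x)

  Settled : Env n → Set₁
  Settled ρ = ∀ s K → K ⊩ ρ ^ᵉ s ≐ᵉ ρ

  ^ᵉ-settled : ∀ (ρ : Env n) r → Settled (ρ ^ᵉ r)
  ^ᵉ-settled ρ r s K x = ≋⇒⊩≐ K _ _ (^-idem (ρ x) r s)

  Forces-mono : ∀ (φ : Formula n) {ρ} → Monotone (_⊩[ ρ ] φ)
  Forces-mono (x ≐ y) {ρ} _ L⊆K = ⊩≐-mono (ρ x) (ρ y) L⊆K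
  Forces-mono (x ∈̇ y) {ρ} _ L⊆K = ⊩∈̇-mono (ρ x) (ρ y) L⊆K
  Forces-mono ⊥̇ _ L⊆K = ⊩∈̇-mono (emptyTerm T) (emptyTerm T) L⊆K
  Forces-mono (φ ∧̇ ψ) oL L⊆K (Kφ , Kψ) = Forces-mono φ oL L⊆K Kφ , Forces-mono ψ oL L⊆K Kψ
  Forces-mono (φ ∨̇ ψ) oL L⊆K =
    locally-restrict (λ oM M⊆ → Sum.map (Forces-mono φ oM M⊆) (Forces-mono ψ oM M⊆)) oL L⊆K
  Forces-mono (φ ⇒ ψ) oL L⊆K (Kφ⇒ψ , local) =
    (λ M oM M⊆L → Kφ⇒ψ M oM (⊆-trans M⊆L L⊆K)) ,
    (λ r Lr → nbhd-restrict (λ _ M⊆ f N oN N⊆M → f N oN (⊆-trans N⊆M M⊆)) oL Lr (local r (L⊆K r Lr)))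
  Forces-mono (∃̇ φ) oL L⊆K =
    locally-restrict (λ oM M⊆ (σ , Mφ) → σ , Forces-mono φ oM M⊆ Mφ) oL L⊆K
  Forces-mono (∀̇ φ) oL L⊆K (Kφ , local) =
    (λ σ → Forces-mono φ oL L⊆K (Kφ σ)) ,
    (λ r Lr → nbhd-restrict (λ oM M⊆ Mφ σ → Forces-mono φ oM M⊆ (Mφ σ)) oL Lr (local r (L⊆K r Lr)))

  Forces-glue : ∀ (φ : Formula n) {ρ} → Locally J (_⊩[ ρ ] φ) → J ⊩[ ρ ] φ
  Forces-glue (x ≐ y) {ρ} = ⊩≐-glue (ρ x) (ρ y)
  Forces-glue (x ∈̇ y) {ρ} = ⊩∈̇-glue (ρ x) (ρ y)
  Forces-glue ⊥̇ = ⊩∈̇-glue (emptyTerm T) (emptyTerm T)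
  Forces-glue (φ ∧̇ ψ) cover =
    Forces-glue φ (locally-map (λ _ _ → proj₁) cover) ,
    Forces-glue ψ (locally-map (λ _ _ → proj₂) cover)
  Forces-glue (φ ∨̇ ψ) = locally-join
  Forces-glue (φ ⇒ ψ) cover =
    (λ K oK K⊆J Kφ → Forces-glue ψ
      (locally-map (λ oL L⊆K (Lφ⇒ψ , _) → Lφ⇒ψ _ oL ⊆-refl (Forces-mono φ oL L⊆K Kφ))
                   (locally-restrict (Forces-mono (φ ⇒ ψ)) oK K⊆J cover))) ,
    (λ r Jr → nbhd-bind (cover r Jr) λ _ Kr (_ , local) → local r Kr)
  Forces-glue (∃̇ φ) = locally-join
  Forces-glue (∀̇ φ) cover =
    (λ σ → Forces-glue φ (locally-map (λ _ _ (Kφ , _) → Kφ σ) cover)) ,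
    (λ r Jr → nbhd-bind (cover r Jr) λ _ Kr (_ , local) → local r Kr)

  Forces-subst : ∀ (φ : Formula n) {ρ ρ'} → Open J → J ⊩ ρ ≐ᵉ ρ' → J ⊩[ ρ ] φ → J ⊩[ ρ' ] φ
  Forces-subst (x ≐ y) {ρ} {ρ'} _ ρ≐ρ' ρx≐ρy =
    ⊩≐-trans (ρ' x) (ρ x) (ρ' y) (⊩≐-sym (ρ x) (ρ' x) (ρ≐ρ' x))
      (⊩≐-trans (ρ x) (ρ y) (ρ' y) ρx≐ρy (ρ≐ρ' y))
  Forces-subst (x ∈̇ y) {ρ} {ρ'} oJ ρ≐ρ' ρx∈ρy =
    ⊩∈̇-respʳ (ρ' x) (ρ y) (ρ' y) (⊩∈̇-respˡ oJ (ρ x) (ρ' x) (ρ y) (ρ≐ρ' x) ρx∈ρy) (ρ≐ρ' y)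
  Forces-subst ⊥̇ _ _ J⊥ = J⊥
  Forces-subst (φ ∧̇ ψ) oJ ρ≐ρ' (Jφ , Jψ) = Forces-subst φ oJ ρ≐ρ' Jφ , Forces-subst ψ oJ ρ≐ρ' Jψ
  Forces-subst (φ ∨̇ ψ) _ ρ≐ρ' = locally-map λ oK K⊆J →
    Sum.map (Forces-subst φ oK (≐ᵉ-mono K⊆J ρ≐ρ')) (Forces-subst ψ oK (≐ᵉ-mono K⊆J ρ≐ρ'))
  Forces-subst (φ ⇒ ψ) _ ρ≐ρ' (Jφ⇒ψ , local) =
    (λ K oK K⊆J → transport oK (≐ᵉ-mono K⊆J ρ≐ρ') (Jφ⇒ψ K oK K⊆J)) ,
    (λ r Jr → nbhd-map (λ _ _ f M oM M⊆K → transport oM (≐ᵉ-^ ρ≐ρ' Jr) (f M oM M⊆K)) (local r Jr))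
    where
    transport : ∀ {K} {ρ ρ' : Env _} → Open K → K ⊩ ρ ≐ᵉ ρ'
              → (K ⊩[ ρ ] φ → K ⊩[ ρ ] ψ) → K ⊩[ ρ' ] φ → K ⊩[ ρ' ] ψ
    transport oK e f = Forces-subst ψ oK e ∘ f ∘ Forces-subst φ oK (≐ᵉ-sym e)
  Forces-subst (∃̇ φ) _ ρ≐ρ' = locally-map λ oK K⊆J (σ , Kφ) →
    σ , Forces-subst φ oK (≐ᵉ-∷ (⊩≐-refl _ σ) (≐ᵉ-mono K⊆J ρ≐ρ')) Kφ
  Forces-subst (∀̇ φ) oJ ρ≐ρ' (Jφ , local) =
    (λ σ → Forces-subst φ oJ (≐ᵉ-∷ (⊩≐-refl _ σ) ρ≐ρ') (Jφ σ)) ,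
    (λ r Jr → nbhd-map (λ oK _ Kφ σ → Forces-subst φ oK (≐ᵉ-∷ (⊩≐-refl _ σ) (≐ᵉ-^ ρ≐ρ' Jr)) (Kφ σ))
                       (local r Jr))

  Forces-rename⁺ : ∀ {m} (φ : Formula m) (f : Fin m → Fin n) {ρ : Env n} {ρ' : Env m}
                 → ρ' ≗ ρ ∘ f → J ⊩[ ρ' ] φ → J ⊩[ ρ ] rename f φ
  Forces-rename⁻ : ∀ {m} (φ : Formula m) (f : Fin m → Fin n) {ρ : Env n} {ρ' : Env m}
                 → ρ' ≗ ρ ∘ f → J ⊩[ ρ ] rename f φ → J ⊩[ ρ' ] φ

  Forces-rename⁺ {J = J} (x ≐ y) _ ρ'≗ρf = subst₂ (J ⊩_≐_) (ρ'≗ρf x) (ρ'≗ρf y)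
  Forces-rename⁺ {J = J} (x ∈̇ y) _ ρ'≗ρf = subst₂ (J ⊩_∈̇_) (ρ'≗ρf x) (ρ'≗ρf y)
  Forces-rename⁺ ⊥̇ _ _ J⊥ = J⊥
  Forces-rename⁺ (φ ∧̇ ψ) f ρ'≗ρf (Jφ , Jψ) =
    Forces-rename⁺ φ f ρ'≗ρf Jφ , Forces-rename⁺ ψ f ρ'≗ρf Jψ
  Forces-rename⁺ (φ ∨̇ ψ) f ρ'≗ρf =
    locally-map λ _ _ → Sum.map (Forces-rename⁺ φ f ρ'≗ρf) (Forces-rename⁺ ψ f ρ'≗ρf)
  Forces-rename⁺ (φ ⇒ ψ) f {ρ} ρ'≗ρf (Jφ⇒ψ , local) =
    (λ K oK K⊆J → Forces-rename⁺ ψ f ρ'≗ρf ∘ Jφ⇒ψ K oK K⊆J ∘ Forces-rename⁻ φ f ρ'≗ρf) ,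
    (λ r Jr → nbhd-map (λ _ _ g M oM M⊆K →
       Forces-rename⁺ ψ f (^ᵉ-≗ ρ f ρ'≗ρf) ∘ g M oM M⊆K ∘ Forces-rename⁻ φ f (^ᵉ-≗ ρ f ρ'≗ρf)) (local r Jr))
  Forces-rename⁺ (∃̇ φ) f ρ'≗ρf =
    locally-map λ _ _ (σ , Kφ) → σ , Forces-rename⁺ φ (ext f) (∷ᵉ-≗ ρ'≗ρf) Kφ
  Forces-rename⁺ (∀̇ φ) f {ρ} ρ'≗ρf (Jφ , local) =
    (λ σ → Forces-rename⁺ φ (ext f) (∷ᵉ-≗ ρ'≗ρf) (Jφ σ)) ,
    (λ r Jr → nbhd-map (λ _ _ Kφ σ → Forces-rename⁺ φ (ext f) (∷ᵉ-≗ (^ᵉ-≗ ρ f ρ'≗ρf)) (Kφ σ)) (local r Jr))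

  Forces-rename⁻ {J = J} (x ≐ y) _ ρ'≗ρf = subst₂ (J ⊩_≐_) (sym (ρ'≗ρf x)) (sym (ρ'≗ρf y))
  Forces-rename⁻ {J = J} (x ∈̇ y) _ ρ'≗ρf = subst₂ (J ⊩_∈̇_) (sym (ρ'≗ρf x)) (sym (ρ'≗ρf y))
  Forces-rename⁻ ⊥̇ _ _ J⊥ = J⊥
  Forces-rename⁻ (φ ∧̇ ψ) f ρ'≗ρf (Jφ , Jψ) =
    Forces-rename⁻ φ f ρ'≗ρf Jφ , Forces-rename⁻ ψ f ρ'≗ρf Jψ
  Forces-rename⁻ (φ ∨̇ ψ) f ρ'≗ρf =
    locally-map λ _ _ → Sum.map (Forces-rename⁻ φ f ρ'≗ρf) (Forces-rename⁻ ψ f ρ'≗ρf)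
  Forces-rename⁻ (φ ⇒ ψ) f {ρ} ρ'≗ρf (Jφ⇒ψ , local) =
    (λ K oK K⊆J → Forces-rename⁻ ψ f ρ'≗ρf ∘ Jφ⇒ψ K oK K⊆J ∘ Forces-rename⁺ φ f ρ'≗ρf) ,
    (λ r Jr → nbhd-map (λ _ _ g M oM M⊆K →
       Forces-rename⁻ ψ f (^ᵉ-≗ ρ f ρ'≗ρf) ∘ g M oM M⊆K ∘ Forces-rename⁺ φ f (^ᵉ-≗ ρ f ρ'≗ρf)) (local r Jr))
  Forces-rename⁻ (∃̇ φ) f ρ'≗ρf =
    locally-map λ _ _ (σ , Kφ) → σ , Forces-rename⁻ φ (ext f) (∷ᵉ-≗ ρ'≗ρf) Kφ
  Forces-rename⁻ (∀̇ φ) f {ρ} ρ'≗ρf (Jφ , local) =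
    (λ σ → Forces-rename⁻ φ (ext f) (∷ᵉ-≗ ρ'≗ρf) (Jφ σ)) ,
    (λ r Jr → nbhd-map (λ _ _ Kφ σ → Forces-rename⁻ φ (ext f) (∷ᵉ-≗ (^ᵉ-≗ ρ f ρ'≗ρf)) (Kφ σ)) (local r Jr))

  Forces-[]⁺ : ∀ (φ : Formula (suc n)) t {ρ} → J ⊩[ ρ t ∷ᵉ ρ ] φ → J ⊩[ ρ ] φ [ t ]
  Forces-[]⁺ φ _ = Forces-rename⁺ φ _ λ { zero → refl ; (suc _) → refl }

  Forces-[]⁻ : ∀ (φ : Formula (suc n)) t {ρ} → J ⊩[ ρ ] φ [ t ] → J ⊩[ ρ t ∷ᵉ ρ ] φ
  Forces-[]⁻ φ _ = Forces-rename⁻ φ _ λ { zero → refl ; (suc _) → refl }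

  Forces-wk⁺ : ∀ (φ : Formula n) {ρ σ} → J ⊩[ ρ ] φ → J ⊩[ σ ∷ᵉ ρ ] wk φ
  Forces-wk⁺ φ = Forces-rename⁺ φ suc λ _ → refl

  Forces-wk⁻ : ∀ (φ : Formula n) {ρ σ} → J ⊩[ σ ∷ᵉ ρ ] wk φ → J ⊩[ ρ ] φ
  Forces-wk⁻ φ = Forces-rename⁻ φ suc λ _ → refl

  ⇒-settled : ∀ (φ ψ : Formula n) → Open K → Settled ρ
            → (∀ L → Open L → L ⊆ K → L ⊩[ ρ ] φ → L ⊩[ ρ ] ψ) → K ⊩[ ρ ] φ ⇒ ψ
  ⇒-settled φ ψ oK settled Kφ⇒ψ =
    Kφ⇒ψ ,
    λ s Ks → nbhd-refl oK Ks λ L oL L⊆K →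
      Forces-subst ψ oL (≐ᵉ-sym (settled s L)) ∘ Kφ⇒ψ L oL L⊆K ∘ Forces-subst φ oL (settled s L)

  ∀-settled : ∀ (φ : Formula (suc n)) → Open K → Settled ρ
            → (∀ σ → K ⊩[ σ ∷ᵉ ρ ] φ) → K ⊩[ ρ ] ∀̇ φ
  ∀-settled {K = K} φ oK settled Kφ =
    Kφ ,
    λ s Ks → nbhd-refl oK Ks λ σ →
      Forces-subst φ oK (≐ᵉ-∷ (⊩≐-refl K σ) (≐ᵉ-sym (settled s K))) (Kφ σ)

  Forces-localise : ∀ (φ : Formula n) {ρ} → Open J → J ⊩[ ρ ] φ → J r → Nbhd J r (_⊩[ ρ ^ᵉ r ] φ)
  Forces-localise (x ≐ y) {ρ} oJ ρx≐ρy Jr = nbhd-refl oJ Jr (⊩≐-^ (ρ x) (ρ y) ρx≐ρy Jr)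
  Forces-localise (x ∈̇ y) {ρ} oJ ρx∈ρy Jr = nbhd-refl oJ Jr (⊩∈̇-^ (ρ x) (ρ y) ρx∈ρy Jr)
  Forces-localise ⊥̇ _ J⊥ Jr = ⊥-elim (⊩⊥̇⇒empty J⊥ Jr)
  Forces-localise (φ ∧̇ ψ) oJ (Jφ , Jψ) Jr =
    nbhd-× (Forces-mono φ) (Forces-mono ψ) (Forces-localise φ oJ Jφ Jr) (Forces-localise ψ oJ Jψ Jr)
  Forces-localise {r = r} (φ ∨̇ ψ) _ Jφ∨ψ Jr =
    nbhd-bind (Jφ∨ψ r Jr) λ oK Kr →
      [ (λ Kφ → nbhd-map (λ oL _ → locally-refl oL ∘ inj₁) (Forces-localise φ oK Kφ Kr))
      , (λ Kψ → nbhd-map (λ oL _ → locally-refl oL ∘ inj₂) (Forces-localise ψ oK Kψ Kr)) ]′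
  Forces-localise {r = r} (φ ⇒ ψ) {ρ} _ (_ , local) Jr =
    nbhd-map (λ oK _ → ⇒-settled φ ψ oK (^ᵉ-settled ρ r)) (local r Jr)
  Forces-localise {r = r} (∃̇ φ) {ρ} _ Jφ Jr =
    nbhd-bind (Jφ r Jr) λ oK Kr (σ , Kφ) →
      nbhd-map (λ oL _ Lφ → locally-refl oL (σ ^ r , Forces-subst φ oL (≐ᵉ-reflexive (^ᵉ-∷ᵉ σ ρ r)) Lφ))
               (Forces-localise φ oK Kφ Kr)
  Forces-localise {r = r} (∀̇ φ) {ρ} _ (_ , local) Jr =
    nbhd-map (λ oK _ → ∀-settled φ oK (^ᵉ-settled ρ r)) (local r Jr)

  All-Forces-mono : ∀ {Γ : List (Formula n)} → Monotone (λ K → All (K ⊩[ ρ ]_) Γ)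
  All-Forces-mono oL L⊆K = All.map λ {φ} → Forces-mono φ oL L⊆K

  All-Forces-localise : ∀ (Γ : List (Formula n)) → Open J → All (J ⊩[ ρ ]_) Γ → J r
                      → Nbhd J r (λ K → All (K ⊩[ ρ ^ᵉ r ]_) Γ)
  All-Forces-localise [] oJ [] Jr = nbhd-refl oJ Jr []
  All-Forces-localise (φ ∷ Γ) oJ (Jφ ∷ JΓ) Jr =
    nbhd-map (λ _ _ (Kφ , KΓ) → Kφ ∷ KΓ)
      (nbhd-× (Forces-mono φ) All-Forces-mono
              (Forces-localise φ oJ Jφ Jr) (All-Forces-localise Γ oJ JΓ Jr))

  All-Forces-wk⁺ : ∀ {Γ : List (Formula n)} σ → All (J ⊩[ ρ ]_) Γ → All (J ⊩[ σ ∷ᵉ ρ ]_) (map wk Γ)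
  All-Forces-wk⁺ _ = map⁺ ∘ All.map λ {φ} → Forces-wk⁺ φ

  Forces-sound : ∀ {Γ : List (Formula n)} {φ} → Γ ⊢ φ
               → ∀ J → Open J → ∀ ρ → All (J ⊩[ ρ ]_) Γ → J ⊩[ ρ ] φ
  Forces-sound (hyp φ∈Γ) _ _ _ JΓ = lookup JΓ φ∈Γ
  Forces-sound (∧I ⊢φ ⊢ψ) J oJ ρ JΓ = Forces-sound ⊢φ J oJ ρ JΓ , Forces-sound ⊢ψ J oJ ρ JΓ
  Forces-sound (∧E₁ ⊢φ∧ψ) J oJ ρ JΓ = proj₁ (Forces-sound ⊢φ∧ψ J oJ ρ JΓ)
  Forces-sound (∧E₂ ⊢φ∧ψ) J oJ ρ JΓ = proj₂ (Forces-sound ⊢φ∧ψ J oJ ρ JΓ)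
  Forces-sound (∨I₁ ⊢φ) J oJ ρ JΓ = locally-refl oJ (inj₁ (Forces-sound ⊢φ J oJ ρ JΓ))
  Forces-sound (∨I₂ ⊢ψ) J oJ ρ JΓ = locally-refl oJ (inj₂ (Forces-sound ⊢ψ J oJ ρ JΓ))
  Forces-sound (∨E {χ = χ} ⊢φ∨ψ φ⊢χ ψ⊢χ) J oJ ρ JΓ =
    Forces-glue χ (locally-map (λ oK K⊆J →
      [ (λ Kφ → Forces-sound φ⊢χ _ oK ρ (Kφ ∷ All-Forces-mono oK K⊆J JΓ))
      , (λ Kψ → Forces-sound ψ⊢χ _ oK ρ (Kψ ∷ All-Forces-mono oK K⊆J JΓ)) ]′)
      (Forces-sound ⊢φ∨ψ J oJ ρ JΓ))
  Forces-sound (⇒I {Γ = Γ} φ⊢ψ) J oJ ρ JΓ =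
    (λ K oK K⊆J Kφ → Forces-sound φ⊢ψ K oK ρ (Kφ ∷ All-Forces-mono oK K⊆J JΓ)) ,
    (λ r Jr → nbhd-map (λ _ _ KΓ L oL L⊆K Lφ →
                 Forces-sound φ⊢ψ L oL (ρ ^ᵉ r) (Lφ ∷ All-Forces-mono oL L⊆K KΓ))
               (All-Forces-localise Γ oJ JΓ Jr))
  Forces-sound (⇒E ⊢φ⇒ψ ⊢φ) J oJ ρ JΓ =
    proj₁ (Forces-sound ⊢φ⇒ψ J oJ ρ JΓ) J oJ ⊆-refl (Forces-sound ⊢φ J oJ ρ JΓ)
  Forces-sound (⊥E {φ = φ} ⊢⊥) J oJ ρ JΓ =
    Forces-glue φ λ _ Jr → ⊥-elim (⊩⊥̇⇒empty (Forces-sound ⊢⊥ J oJ ρ JΓ) Jr)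
  Forces-sound (∀I {Γ = Γ} ⊢φ) J oJ ρ JΓ =
    (λ σ → Forces-sound ⊢φ J oJ (σ ∷ᵉ ρ) (All-Forces-wk⁺ σ JΓ)) ,
    (λ r Jr → nbhd-map (λ oK _ KΓ σ → Forces-sound ⊢φ _ oK (σ ∷ᵉ ρ ^ᵉ r) (All-Forces-wk⁺ σ KΓ))
                       (All-Forces-localise Γ oJ JΓ Jr))
  Forces-sound (∀E {φ = φ} ⊢∀φ t) J oJ ρ JΓ =
    Forces-[]⁺ φ t (proj₁ (Forces-sound ⊢∀φ J oJ ρ JΓ) (ρ t))
  Forces-sound (∃I {φ = φ} t ⊢φ[t]) J oJ ρ JΓ =
    locally-refl oJ (ρ t , Forces-[]⁻ φ t (Forces-sound ⊢φ[t] J oJ ρ JΓ))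
  Forces-sound (∃E {ψ = ψ} ⊢∃φ φ⊢ψ) J oJ ρ JΓ =
    Forces-glue ψ (locally-map (λ oK K⊆J (σ , Kφ) →
      Forces-wk⁻ ψ (Forces-sound φ⊢ψ _ oK (σ ∷ᵉ ρ) (Kφ ∷ All-Forces-wk⁺ σ (All-Forces-mono oK K⊆J JΓ))))
      (Forces-sound ⊢∃φ J oJ ρ JΓ))
  Forces-sound (refl≐ x) J _ ρ _ = ⊩≐-refl J (ρ x)
  Forces-sound (subst≐ φ {x} {y} ⊢x≐y ⊢φ[x]) J oJ ρ JΓ =
    Forces-[]⁺ φ y (Forces-subst φ oJ (≐ᵉ-∷ (Forces-sound ⊢x≐y J oJ ρ JΓ) (≐ᵉ-refl J ρ))
                     (Forces-[]⁻ φ x (Forces-sound ⊢φ[x] J oJ ρ JΓ)))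

mainTheorem1 : (T : Space)
    → (∀ {n} (φ : Formula n) → [] ⊢ φ
    → ∀ (J : Subset T) → Space.Open T J → (ρ : Fin n → Term T) → Forces T J ρ φ)
    × (∀ {n} (Γ : List (Formula n)) (φ : Formula n) → Γ ⊢ φ
    → ∀ (J : Subset T) → Space.Open T J → (ρ : Fin n → Term T)
    → All (Forces T J ρ) Γ → Forces T J ρ φ)
mainTheorem1 T =
  (λ _ ⊢φ J oJ ρ → Forces-sound ⊢φ J oJ ρ []) ,
  (λ _ _ → Forces-sound)
  where open Soundness T
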